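{- Let $(P,\leq,{}',R,0,1)$ be a conditionally operator residuated poset satisfying operator divisibility, and assume $R(x,y)=LU(x',y)$ for all $x,y\in P$. Then $(P,\leq,{}',0,1)$ is a generalized orthomodular poset.
   Context: For a poset $(P,\leq)$ and $A\subseteq P$, $L(A)=\{x\in P\mid x\leq a\text{ for all }a\in A\}$ and $U(A)=\{x\in P\mid a\leq x\text{ for all }a\in A\}$; we write $L(a,b)=L(\{a,b\})$, $L(a,B)=L(\{a\}\cup B)$, $LU(A)=L(U(A))$, etc. A unary operation $'$ on a poset is an antitone involution if $x''=x$ and $x\leq y$ implies $y'\leq x'$; on a bounded poset it is a complementation if $L(x,x')=\{0\}$ and $U(x,x')=\{1\}$ for all $x$. An orthoposet is a bounded poset $(P,\leq,{}',0,1)$ with an antitone involution $'$ which is a complementation. A generalized orthomodular poset is an orthoposet such that for all $x,y\in P$, $x\leq y$ implies $U(y)=U(x,L(x',y))$. A conditionally operator residuated poset is a tuple $(P,\leq,{}',R,0,1)$ where $(P,\leq,0,1)$ is a bounded poset, $'$ is a unary antitone operation on $P$ (i.e. $x\leq y$ implies $y'\leq x'$), and $R:P^2\to 2^P$ satisfies for all $x,y,z\in P$: (i) if $x'\leq y$ then $L(x,y)\subseteq L(z)$ implies $L(x)\subseteq R(y,z)$; (ii) if $z\leq y$ then $L(x)\subseteq R(y,z)$ implies $L(x,y)\subseteq L(z)$; (iii) $R(x,0)=L(x')$; (iv) $R(x'',x)=P$. It satisfies operator divisibility if $x\leq y$ implies $L(y,U(R(y,x)))=L(x)$ for all $x,y\in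 P$. -}

module Defs where

open import Level using (Level; _⊔_; suc)
open import Data.Product using (_×_; _,_)
open import Data.Sum using (_⊎_)
open import Relation.Binary.Bundles using (Poset)

Subset : ∀ {a} (A : Set a) (ℓ : Level) → Set (a ⊔ suc ℓ)
Subset A ℓ = A → Set ℓ

module PosetNotions {c ℓ₁ ℓ₂ : Level} (P : Poset c ℓ₁ ℓ₂) where
  open Poset P renaming (Carrier to C)

  _⊆_ : ∀ {ℓ ℓ'} → Subset C ℓ → Subset C ℓ' → Set (c ⊔ ℓ ⊔ ℓ')
  A ⊆ B = ∀ x → A x → B x

  _≐_ : ∀ {ℓ ℓ'} → Subset C ℓ → Subset C ℓ' → Set (c ⊔ ℓ ⊔ ℓ')
  A ≐ B = (A ⊆ B) × (B ⊆ A)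

  ⟦_⟧ : C → Subset C ℓ₁
  ⟦ a ⟧ x = x ≈ a

  ｛_،_｝ : C → C → Subset C ℓ₁
  ｛ a ، b ｝ x = (x ≈ a) ⊎ (x ≈ b)

  _◂_ : ∀ {ℓ} → C → Subset C ℓ → Subset C (ℓ₁ ⊔ ℓ)
  (a ◂ B) x = (x ≈ a) ⊎ B x

  L : ∀ {ℓ} → Subset C ℓ → Subset C (c ⊔ ℓ ⊔ ℓ₂)
  L A x = ∀ a → A a → x ≤ a

  U : ∀ {ℓ} → Subset C ℓ → Subset C (c ⊔ ℓ ⊔ ℓ₂)
  U A x = ∀ a → A a → a ≤ x

  Whole : Subset C ℓ₁
  Whole x = x ≈ x

  module Bounded (𝟘 𝟙 : C) (′ : C → C) where
    IsBounded : Set (c ⊔ ℓ₂)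
    IsBounded = (∀ x → 𝟘 ≤ x) × (∀ x → x ≤ 𝟙)

    Antitone : Set (c ⊔ ℓ₂)
    Antitone = ∀ {x y} → x ≤ y → ′ y ≤ ′ x

    IsAntitoneInvolution : Set (c ⊔ ℓ₁ ⊔ ℓ₂)
    IsAntitoneInvolution = (∀ x → ′ (′ x) ≈ x) × Antitone

    IsComplementation : Set (c ⊔ ℓ₁ ⊔ ℓ₂)
    IsComplementation = ∀ x → (L ｛ x ، ′ x ｝ ≐ ⟦ 𝟘 ⟧) × (U ｛ x ، ′ x ｝ ≐ ⟦ 𝟙 ⟧)

    IsOrthoposet : Set (c ⊔ ℓ₁ ⊔ ℓ₂)
    IsOrthoposet = IsBounded × IsAntitoneInvolution × IsComplementation

    IsGeneralizedOrthomodular : Set (c ⊔ ℓ₁ ⊔ ℓ₂)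
    IsGeneralizedOrthomodular =
      IsOrthoposet ×
      (∀ {x y} → x ≤ y → U ⟦ y ⟧ ≐ U (x ◂ L ｛ ′ x ، y ｝))

    module _ {r : Level} (R : C → C → Subset C r) where
      IsConditionallyOperatorResiduated : Set (c ⊔ ℓ₁ ⊔ ℓ₂ ⊔ r)
      IsConditionallyOperatorResiduated =
        IsBounded × Antitone ×
        (∀ x y z → ′ x ≤ y → L ｛ x ، y ｝ ⊆ L ⟦ z ⟧ → L ⟦ x ⟧ ⊆ R y z) ×
        (∀ x y z → z ≤ y → L ⟦ x ⟧ ⊆ R y z → L ｛ x ، y ｝ ⊆ L ⟦ z ⟧) ×
        (∀ x → R x 𝟘 ≐ L ⟦ ′ x ⟧) ×
        (∀ x → R (′ (′ x)) x ≐ Whole)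

      OperatorDivisibility : Set (c ⊔ ℓ₁ ⊔ ℓ₂ ⊔ r)
      OperatorDivisibility =
        ∀ {x y} → x ≤ y → L (y ◂ U (R y x)) ≐ L ⟦ x ⟧

module Submission where

open import Defs
open import Level using (Level; _⊔_)
open import Relation.Binary.Bundles using (Poset)
open import Data.Product using (_,_; proj₁; proj₂)
open import Data.Sum using (inj₁; inj₂)

-- Divisibility applied to 0 ≤ y, together with R(y,0) = L(y'), gives L(y,y') = {0}.  Axiom (i)
-- with z = 0 turns this into x ∈ R(x',0) = L(x''), and axiom (ii) with R(x'',x) = P gives x'' ≤ x.
-- For an upper bound u of x and x', the element 1 ∈ R(x'',x) = LU(x''',x) lies below u.  Finally,
-- if x ≤ y and u bounds x and L(x',y), then axiom (i) puts y in R(x',u) = LU(x'',u), so y ≤ u.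

module ConeLemmas {c ℓ₁ ℓ₂ : Level} (P : Poset c ℓ₁ ℓ₂) where
  open Poset P renaming (Carrier to C)
  open PosetNotions P

  L-singleton⁺ : ∀ {w a} → w ≤ a → L ⟦ a ⟧ w
  L-singleton⁺ w≤a b b≈a = ≤-respʳ-≈ (Eq.sym b≈a) w≤a

  L-singleton⁻ : ∀ {w a} → L ⟦ a ⟧ w → w ≤ a
  L-singleton⁻ {a = a} w∈La = w∈La a Eq.refl

  U-singleton⁻ : ∀ {u a} → U ⟦ a ⟧ u → a ≤ u
  U-singleton⁻ {a = a} u∈Ua = u∈Ua a Eq.refl

  L-pair⁺ : ∀ {w a b} → w ≤ a → w ≤ b → L ｛ a ، b ｝ w
  L-pair⁺ w≤a w≤b z (inj₁ z≈a) = ≤-respʳ-≈ (Eq.sym z≈a) w≤a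
  L-pair⁺ w≤a w≤b z (inj₂ z≈b) = ≤-respʳ-≈ (Eq.sym z≈b) w≤b

  L-pair⁻ˡ : ∀ {w a b} → L ｛ a ، b ｝ w → w ≤ a
  L-pair⁻ˡ {a = a} w∈L = w∈L a (inj₁ Eq.refl)

  L-pair⁻ʳ : ∀ {w a b} → L ｛ a ، b ｝ w → w ≤ b
  L-pair⁻ʳ {b = b} w∈L = w∈L b (inj₂ Eq.refl)

  U-pair⁺ : ∀ {u a b} → a ≤ u → b ≤ u → U ｛ a ، b ｝ u
  U-pair⁺ a≤u b≤u z (inj₁ z≈a) = ≤-respˡ-≈ (Eq.sym z≈a) a≤u
  U-pair⁺ a≤u b≤u z (inj₂ z≈b) = ≤-respˡ-≈ (Eq.sym z≈b) b≤u

  U-pair⁻ˡ : ∀ {u a b} → U ｛ a ، b ｝ u → a ≤ u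
  U-pair⁻ˡ {a = a} u∈U = u∈U a (inj₁ Eq.refl)

  U-pair⁻ʳ : ∀ {u a b} → U ｛ a ، b ｝ u → b ≤ u
  U-pair⁻ʳ {b = b} u∈U = u∈U b (inj₂ Eq.refl)

  ∈LU : ∀ {ℓ} {A : Subset C ℓ} {w u} → L (U A) w → U A u → w ≤ u
  ∈LU w∈LUA u∈UA = w∈LUA _ u∈UA

module Residuation {c ℓ₁ ℓ₂ r : Level} (P : Poset c ℓ₁ ℓ₂)
    (𝟘 𝟙 : Poset.Carrier P) (′ : Poset.Carrier P → Poset.Carrier P)
    (R : Poset.Carrier P → Poset.Carrier P → Subset (Poset.Carrier P) r) where
  open Poset P renaming (Carrier to C)
  open PosetNotions P
  open Bounded 𝟘 𝟙 ′
  open ConeLemmas P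

  ResiduationIntro : Set (c ⊔ ℓ₁ ⊔ ℓ₂ ⊔ r)
  ResiduationIntro = ∀ x y z → ′ x ≤ y → L ｛ x ، y ｝ ⊆ L ⟦ z ⟧ → L ⟦ x ⟧ ⊆ R y z

  ResiduationElim : Set (c ⊔ ℓ₁ ⊔ ℓ₂ ⊔ r)
  ResiduationElim = ∀ x y z → z ≤ y → L ⟦ x ⟧ ⊆ R y z → L ｛ x ، y ｝ ⊆ L ⟦ z ⟧

  R⊆LU : Set (c ⊔ ℓ₁ ⊔ ℓ₂ ⊔ r)
  R⊆LU = ∀ x y → R x y ⊆ L (U ｛ ′ x ، y ｝)

  meet-complement-≤𝟘 : (∀ x → 𝟘 ≤ x) → OperatorDivisibility R →
                       (∀ y → L ⟦ ′ y ⟧ ⊆ R y 𝟘) →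
                       ∀ {w y} → w ≤ y → w ≤ ′ y → w ≤ 𝟘
  meet-complement-≤𝟘 𝟘-min divisible L′⊆R {w} {y} w≤y w≤y′ =
    L-singleton⁻ (proj₁ (divisible (𝟘-min y)) w w∈L)
    where
    w∈L : L (y ◂ U (R y 𝟘)) w
    w∈L a (inj₁ a≈y) = ≤-respʳ-≈ (Eq.sym a≈y) w≤y
    w∈L a (inj₂ a∈U) = a∈U w (L′⊆R y w (L-singleton⁺ w≤y′))

  ≤-double-complement : ResiduationIntro → (∀ y → R y 𝟘 ⊆ L ⟦ ′ y ⟧) →
                        (∀ {w y} → w ≤ y → w ≤ ′ y → w ≤ 𝟘) →
                        ∀ x → x ≤ ′ (′ x)
  ≤-double-complement intro R⊆L′ meet≤𝟘 x =
    L-singleton⁻ (R⊆L′ (′ x) x (intro x (′ x) 𝟘 refl meet⊆L𝟘 x (L-singleton⁺ refl)))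
    where
    meet⊆L𝟘 : L ｛ x ، ′ x ｝ ⊆ L ⟦ 𝟘 ⟧
    meet⊆L𝟘 w w∈L = L-singleton⁺ (meet≤𝟘 (L-pair⁻ˡ w∈L) (L-pair⁻ʳ w∈L))

  double-complement-≤ : (∀ x → x ≤ 𝟙) → ResiduationElim →
                        (∀ x → Whole ⊆ R (′ (′ x)) x) → (∀ x → x ≤ ′ (′ x)) →
                        ∀ x → ′ (′ x) ≤ x
  double-complement-≤ 𝟙-max elim R-whole ≤′′ x =
    L-singleton⁻ (elim 𝟙 (′ (′ x)) x (≤′′ x) (λ w _ → R-whole x w Eq.refl)
                       (′ (′ x)) (L-pair⁺ (𝟙-max _) refl))

  𝟙-≤-join-complement : R⊆LU → Antitone → (∀ x → Whole ⊆ R (′ (′ x)) x) →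
                        (∀ x → x ≤ ′ (′ x)) →
                        ∀ {u x} → x ≤ u → ′ x ≤ u → 𝟙 ≤ u
  𝟙-≤-join-complement R-LU antitone R-whole ≤′′ {u} {x} x≤u x′≤u =
    ∈LU (R-LU (′ (′ x)) x 𝟙 (R-whole x 𝟙 Eq.refl))
        (U-pair⁺ (trans (antitone (≤′′ x)) x′≤u) x≤u)

  isComplementation : IsBounded → (∀ {w y} → w ≤ y → w ≤ ′ y → w ≤ 𝟘) →
                      (∀ {u x} → x ≤ u → ′ x ≤ u → 𝟙 ≤ u) → IsComplementation
  isComplementation (𝟘-min , 𝟙-max) meet≤𝟘 𝟙≤join x =
    ( (λ w w∈L → antisym (meet≤𝟘 (L-pair⁻ˡ w∈L) (L-pair⁻ʳ w∈L)) (𝟘-min w))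
    , (λ w w≈𝟘 a _ → ≤-respˡ-≈ (Eq.sym w≈𝟘) (𝟘-min a)) )
    , ( (λ u u∈U → antisym (𝟙-max u) (𝟙≤join (U-pair⁻ˡ u∈U) (U-pair⁻ʳ u∈U)))
      , (λ u u≈𝟙 a _ → ≤-respʳ-≈ (Eq.sym u≈𝟙) (𝟙-max a)) )

  generalized-orthomodular-law : ResiduationIntro → R⊆LU → Antitone →
                                 (∀ x → ′ (′ x) ≤ x) →
                                 ∀ {x y} → x ≤ y → U ⟦ y ⟧ ≐ U (x ◂ L ｛ ′ x ، y ｝)
  generalized-orthomodular-law intro R-LU antitone ′′≤ {x} {y} x≤y = Uy⊆ , ⊆Uy
    where
    Uy⊆ : U ⟦ y ⟧ ⊆ U (x ◂ L ｛ ′ x ، y ｝)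
    Uy⊆ u u∈Uy a (inj₁ a≈x) = ≤-respˡ-≈ (Eq.sym a≈x) (trans x≤y (U-singleton⁻ u∈Uy))
    Uy⊆ u u∈Uy a (inj₂ a∈L) = trans (L-pair⁻ʳ a∈L) (U-singleton⁻ u∈Uy)

    ⊆Uy : U (x ◂ L ｛ ′ x ، y ｝) ⊆ U ⟦ y ⟧
    ⊆Uy u u∈U a a≈y = ≤-respˡ-≈ (Eq.sym a≈y) y≤u
      where
      x≤u : x ≤ u
      x≤u = u∈U x (inj₁ Eq.refl)

      y∈R : R (′ x) u y
      y∈R = intro y (′ x) u (antitone x≤y)
              (λ w w∈L → L-singleton⁺ (u∈U w (inj₂ (L-pair⁺ (L-pair⁻ʳ w∈L) (L-pair⁻ˡ w∈L)))))
              y (L-singleton⁺ refl)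

      y≤u : y ≤ u
      y≤u = ∈LU (R-LU (′ x) u y y∈R) (U-pair⁺ (trans (′′≤ x) x≤u) refl)

mainTheorem2 : {c ℓ₁ ℓ₂ r : Level} (P : Poset c ℓ₁ ℓ₂)
    → (𝟘 𝟙 : Poset.Carrier P) (′ : Poset.Carrier P → Poset.Carrier P)
    → (R : Poset.Carrier P → Poset.Carrier P → Subset (Poset.Carrier P) r)
    → PosetNotions.Bounded.IsConditionallyOperatorResiduated P 𝟘 𝟙 ′ R
    → PosetNotions.Bounded.OperatorDivisibility P 𝟘 𝟙 ′ R
    → (∀ x y → PosetNotions._≐_ P (R x y)
                 (PosetNotions.L P (PosetNotions.U P (PosetNotions.｛_،_｝ P (′ x) y))))
    → PosetNotions.Bounded.IsGeneralizedOrthomodular P 𝟘 𝟙 ′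
mainTheorem2 P 𝟘 𝟙 ′ R
  (bounded@(𝟘-min , 𝟙-max) , antitone , intro , elim , R-𝟘 , R-whole) divisible R≐LU =
  (bounded , ((λ x → antisym (′′≤ x) (≤′′ x)) , antitone) , isComplementation bounded meet≤𝟘 𝟙≤join) ,
  generalized-orthomodular-law intro R-LU antitone ′′≤
  where
  open Poset P using (_≤_; antisym)
  open PosetNotions P using (_⊆_; Whole)
  open Residuation P 𝟘 𝟙 ′ R

  R-LU : R⊆LU
  R-LU x y = proj₁ (R≐LU x y)

  R-whole⁻ : ∀ x → Whole ⊆ R (′ (′ x)) x
  R-whole⁻ x = proj₂ (R-whole x)

  meet≤𝟘 : ∀ {w y} → w ≤ y → w ≤ ′ y → w ≤ 𝟘
  meet≤𝟘 = meet-complement-≤𝟘 𝟘-min divisible (λ y → proj₂ (R-𝟘 y))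

  ≤′′ : ∀ x → x ≤ ′ (′ x)
  ≤′′ = ≤-double-complement intro (λ y → proj₁ (R-𝟘 y)) meet≤𝟘

  ′′≤ : ∀ x → ′ (′ x) ≤ x
  ′′≤ = double-complement-≤ 𝟙-max elim R-whole⁻ ≤′′

  𝟙≤join : ∀ {u x} → x ≤ u → ′ x ≤ u → 𝟙 ≤ u
  𝟙≤join = 𝟙-≤-join-complement R-LU antitone R-whole⁻ ≤′′
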